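{- Let $n\ge 2$, $0\le k\le n-1$, and $\omega_k=(0,\dots,0,1,\dots,1,0)\in\mathbb{Z}_3^n\times\mathbb{Z}$ (with $k$ zeros, then $n-k$ ones, then last coordinate $0$). For every $u\in\widetilde{C}_n$, \[ \rho(u)(\omega_k)=\Big(\varepsilon_k(u^{ -1}(1)),\dots,\varepsilon_k(u^{ -1}(n)),P_k(u)\Big), \] where \[ P_k(u)=\frac{\sum_{j=1}^n\varepsilon_k(j)\,j-\sum_{j=1}^n\varepsilon_k(u^{ -1}(j))\,u^{ -1}(j)}{2n+1}\in\mathbb{Z}. \]
   Context: $\widetilde{C}_n$ ($n\ge2$) is realized as the group of bijections $u:\mathbb{Z}\to\mathbb{Z}$ with $u(-i)=-u(i)$ and $u(i+2n+1)=u(i)+2n+1$ for all $i$, under composition $(uv)(x)=u(v(x))$; $u$ is determined by its window $[u(1),\dots,u(n)]$. Its Coxeter generators are $s_0=[-1,2,\dots,n]$, $s_i=[1,\dots,i-1,i+1,i,i+2,\dots,n]$ for $0<i<n$, and $s_n=[1,\dots,n-1,n+1]$. Let $\mathbb{Z}_3=\{1,0,-1\}$. The homomorphism $\rho:\widetilde{C}_n\to\mathrm{Sym}(\mathbb{Z}_3^n\times\mathbb{Z})$ is defined on generators by $\rho(s_0)(a_1,\dots,a_n,b)=(-a_1,a_2,\dots,a_n,b)$; for $0<i<n$, $\rho(s_i)$ swaps $a_i$ and $a_{i+1}$; $\rho(s_n)(a_1,\dots,a_n,b)=(a_1,\dots,a_{n-1},-a_n,b+a_n)$. The $k$-sign of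 $t\in\mathbb{Z}$ is $\varepsilon_k(t)=1$ if $t\equiv k+1,\dots,n\pmod{2n+1}$, $\varepsilon_k(t)=0$ if $t\equiv -k,\dots,k\pmod{2n+1}$, and $\varepsilon_k(t)=-1$ if $t\equiv -n,\dots,-(k+1)\pmod{2n+1}$. -}

module Defs where

open import Data.Nat as ℕ using (ℕ; zero; suc; _≡ᵇ_; _≤ᵇ_)
open import Data.Integer as ℤ using (ℤ; +_; -_; _+_; _-_; _*_; _%ℕ_)
open import Data.Fin using (Fin; toℕ)
open import Data.List using (List; foldr)
open import Data.Bool using (Bool; true; false; if_then_else_; _∧_; _∨_)
open import Data.Product using (_×_; _,_)

modulus : ℕ → ℕ
modulus n = suc (2 ℕ.* n)

res : ℕ → ℤ → ℕ
res n x = x %ℕ modulus n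

-- Action of the Coxeter generator s_i (0 ≤ i ≤ n) of C̃_n on ℤ, i.e. the
-- unique bijection with the given window that is odd and satisfies
-- s(x + 2n+1) = s(x) + 2n+1.
genAct : (n i : ℕ) → ℤ → ℤ
genAct n i x with i ≡ᵇ 0 | i ≡ᵇ n
... | true | _ =                       -- s_0 = [-1,2,…,n]
  if r ≡ᵇ 1 then x - + 2
  else if r ≡ᵇ 2 ℕ.* n then x + + 2
  else x
  where r = res n x
... | false | true =                  -- s_n = [1,…,n-1,n+1]
  if r ≡ᵇ n then x + + 1
  else if r ≡ᵇ suc n then x - + 1
  else x
  where r = res n x
... | false | false =                 -- s_i swaps i,i+1 (and -i,-(i+1))
  if r ≡ᵇ i then x + + 1
  else if r ≡ᵇ suc i then x - + 1
  else if r ≡ᵇ (modulus n ℕ.∸ i) then x - + 1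
  else if r ≡ᵇ (modulus n ℕ.∸ suc i) then x + + 1
  else x
  where r = res n x

-- A word [i₁,…,iₘ] represents u = s_{i₁} s_{i₂} ⋯ s_{iₘ} ∈ C̃_n,
-- with (uv)(x) = u(v(x)).
act : (n : ℕ) → List (Fin (suc n)) → ℤ → ℤ
act n w x = foldr (λ i y → genAct n (toℕ i) y) x w

-- States (a₁,…,aₙ,b) ∈ ℤ₃ⁿ × ℤ, with a given as a function of the
-- position j ∈ {1,…,n} (values at other positions are irrelevant).
State : Set
State = (ℕ → ℤ) × ℤ

rhoGen : (n i : ℕ) → State → State
rhoGen n i (a , b) with i ≡ᵇ 0 | i ≡ᵇ n
... | true | _ = (λ j → if j ≡ᵇ 1 then - a 1 else a j) , b
... | false | true = (λ j → if j ≡ᵇ n then - a n else a j) , b + a n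
... | false | false =
  (λ j → if j ≡ᵇ i then a (suc i) else if j ≡ᵇ suc i then a i else a j) , b

rho : (n : ℕ) → List (Fin (suc n)) → State → State
rho n w σ = foldr (λ i τ → rhoGen n (toℕ i) τ) σ w

omega : ℕ → State
omega k = (λ j → if j ≤ᵇ k then + 0 else + 1) , + 0

eps : (n k : ℕ) → ℤ → ℤ
eps n k t =
  if (r ≤ᵇ k) ∨ ((modulus n ℕ.∸ k) ≤ᵇ r) then + 0
  else if r ≤ᵇ n then + 1
  else - + 1
  where r = res n t

sumTo : ℕ → (ℕ → ℤ) → ℤ
sumTo zero f = + 0
sumTo (suc m) f = sumTo m f + f (suc m)

-- Write U for u⁻¹. Prepending a generator, u ↦ s_i u, replaces U by U ∘ s_i, so the
-- formula is proved by induction on the word, simultaneously for every right inverse U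
-- of its action. On the window {1,…,n}, s_i (0 < i < n) swaps i and i+1, s₀ sends 1 to
-- −1 and sₙ sends n to n+1 = −n + (2n+1). As U is odd and commutes with translation by
-- 2n+1, while ε_k is odd and (2n+1)-periodic, the new signs ε_k(U(s_i j)) are exactly the
-- coordinates produced by ρ(s_i). Only ρ(sₙ) changes the last coordinate, by a_n =
-- ε_k(U n), matching the change −(2n+1)·ε_k(U n) of Σ_j ε_k(U j)·U j. That the generators
-- are odd, translation-equivariant involutions of ℤ is checked on residues mod 2n+1,
-- where each of them moves only two or four classes.

module Submission where

open import Defs
open import Data.Nat as ℕ using (ℕ; zero; suc; _≤_; _<_; z≤n; s≤s; _≡ᵇ_; _≤ᵇ_; _≟_; _≤?_)
import Data.Nat.Properties as ℕₚ
open import Data.Nat.DivMod using (m<n⇒m%n≡m; n%n≡0)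
open import Data.Integer as ℤ using (ℤ; +_; -_; _+_; _-_; _*_; ∣_∣; _⊖_)
import Data.Integer.Properties as ℤₚ
open import Data.Integer.DivMod using (a≡a%ℕn+[a/ℕn]*n; n%ℕd<d)
open import Data.Integer.Tactic.RingSolver using (solve-∀)
open import Data.Bool using (Bool; true; false; if_then_else_; _∨_)
open import Data.Bool.Properties using (∨-zeroʳ)
open import Data.Fin using (Fin; toℕ)
open import Data.Fin.Properties using (toℕ≤pred[n])
open import Data.List using (List; []; _∷_)
open import Data.Product using (_×_; _,_; proj₁; proj₂)
open import Data.Sum using (_⊎_; inj₁; inj₂)
open import Relation.Binary.PropositionalEquality
open import Relation.Nullary using (¬_; yes; no)
open import Relation.Nullary.Decidable using (dec-true; dec-false)
open import Function using (_∘_)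

≡ᵇ-refl : ∀ m → (m ≡ᵇ m) ≡ true
≡ᵇ-refl m = dec-true (m ≟ m) refl

≢⇒≡ᵇ-false : ∀ {m n} → m ≢ n → (m ≡ᵇ n) ≡ false
≢⇒≡ᵇ-false {m} {n} = dec-false (m ≟ n)

≤⇒≤ᵇ-true : ∀ {m n} → m ≤ n → (m ≤ᵇ n) ≡ true
≤⇒≤ᵇ-true {m} {n} = dec-true (m ≤? n)

≰⇒≤ᵇ-false : ∀ {m n} → ¬ m ≤ n → (m ≤ᵇ n) ≡ false
≰⇒≤ᵇ-false {m} {n} = dec-false (m ≤? n)

∸-reflect-≤ : ∀ {N a b} → a ≤ N → N ℕ.∸ a ≤ b → N ℕ.∸ b ≤ a
∸-reflect-≤ {N} {a} {b} a≤N N∸a≤b = subst (N ℕ.∸ b ≤_) (ℕₚ.m∸[m∸n]≡n a≤N) (ℕₚ.∸-monoʳ-≤ N N∸a≤b)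

∸-reflect-< : ∀ {N a b} → a ≤ N → a < N ℕ.∸ b → b < N ℕ.∸ a
∸-reflect-< a≤N a<N∸b = ℕₚ.≰⇒> (λ N∸a≤b → ℕₚ.<⇒≱ a<N∸b (∸-reflect-≤ a≤N N∸a≤b))

∸-flip : ∀ {N r s} → r ≤ N → N ℕ.∸ r ≡ s → r ≡ N ℕ.∸ s
∸-flip {N} r≤N N∸r≡s = trans (sym (ℕₚ.m∸[m∸n]≡n r≤N)) (cong (N ℕ.∸_) N∸r≡s)

modulusℤ : ℕ → ℤ
modulusℤ n = + modulus n

modulus≡1+n+n : ∀ n → modulus n ≡ suc n ℕ.+ n
modulus≡1+n+n n = cong suc (trans (cong (n ℕ.+_) (ℕₚ.+-identityʳ n)) (ℕₚ.+-comm n n))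

modulus∸n : ∀ n → modulus n ℕ.∸ n ≡ suc n
modulus∸n n = trans (cong (ℕ._∸ n) (modulus≡1+n+n n)) (ℕₚ.m+n∸n≡m (suc n) n)

modulus∸1+n : ∀ n → modulus n ℕ.∸ suc n ≡ n
modulus∸1+n n = trans (cong (ℕ._∸ suc n) (modulus≡1+n+n n)) (ℕₚ.m+n∸m≡n (suc n) n)

window<modulus : ∀ {n j} → j ≤ n → j < modulus n
window<modulus {n} j≤n = s≤s (ℕₚ.≤-trans j≤n (ℕₚ.m≤m+n n _))

mod-congruent⇒≡ : ∀ {N a b} (c : ℤ) → a < N → b < N → + a ≡ + b + c * + N → a ≡ b
mod-congruent⇒≡ {N} {a} {b} c a<N b<N a≡b+cN =
  ℤₚ.+-injective (trans a≡b+cN (trans (cong (λ t → + b + t * + N) c≡0) (ℤₚ.+-identityʳ (+ b))))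
  where
  difference : c * + N ≡ + a - + b
  difference = trans (shuffle (+ b) (c * + N)) (cong (_- + b) (sym a≡b+cN))
    where shuffle : ∀ x y → y ≡ (x + y) - x
          shuffle = solve-∀
  ∣c∣N<1N : ∣ c ∣ ℕ.* N < 1 ℕ.* N
  ∣c∣N<1N = begin-strict
    ∣ c ∣ ℕ.* N   ≡⟨ ℤₚ.abs-* c (+ N) ⟨
    ∣ c * + N ∣   ≡⟨ cong ∣_∣ (trans difference (ℤₚ.m-n≡m⊖n a b)) ⟩
    ∣ a ⊖ b ∣     ≤⟨ ℤₚ.∣m⊝n∣≤m⊔n a b ⟩
    a ℕ.⊔ b       <⟨ ℕₚ.⊔-lub a<N b<N ⟩
    N             ≡⟨ ℕₚ.*-identityˡ N ⟨
    1 ℕ.* N       ∎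
    where open ℕₚ.≤-Reasoning
  c≡0 : c ≡ + 0
  c≡0 = ℤₚ.∣i∣≡0⇒i≡0 (ℕₚ.n<1⇒n≡0 (ℕₚ.*-cancelʳ-< N ∣ c ∣ 1 ∣c∣N<1N))

module _ (n : ℕ) where

  res<modulus : ∀ x → res n x < modulus n
  res<modulus x = n%ℕd<d x (modulus n)

  res-decomposition : ∀ x → x ≡ + res n x + (x ℤ./ℕ modulus n) * modulusℤ n
  res-decomposition x = a≡a%ℕn+[a/ℕn]*n x (modulus n)

  res-residue : ∀ {r} → r < modulus n → res n (+ r) ≡ r
  res-residue = m<n⇒m%n≡m

  res-unique : ∀ {r} (q : ℤ) → r < modulus n → res n (+ r + q * modulusℤ n) ≡ r
  res-unique {r} q r<N = mod-congruent⇒≡ (q - q′) (res<modulus x) r<N (begin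
    + res n x                          ≡⟨ cancel (+ res n x) q′ (modulusℤ n) ⟩
    (+ res n x + q′ * modulusℤ n) - q′ * modulusℤ n ≡⟨ cong (_- q′ * modulusℤ n) (res-decomposition x) ⟨
    x - q′ * modulusℤ n                ≡⟨ regroup (+ r) q q′ (modulusℤ n) ⟩
    + r + (q - q′) * modulusℤ n        ∎)
    where
    open ≡-Reasoning
    x = + r + q * modulusℤ n
    q′ = x ℤ./ℕ modulus n
    cancel : ∀ s a m → s ≡ (s + a * m) - a * m
    cancel = solve-∀
    regroup : ∀ s a b m → (s + a * m) - b * m ≡ s + (a - b) * m
    regroup = solve-∀

  res-+-multiple : ∀ x q → res n (x + q * modulusℤ n) ≡ res n x
  res-+-multiple x q = begin
    res n (x + q * N)                        ≡⟨ cong (λ y → res n (y + q * N)) (res-decomposition x) ⟩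
    res n ((+ res n x + q′ * N) + q * N)     ≡⟨ cong (res n) (regroup (+ res n x) q′ q N) ⟩
    res n (+ res n x + (q′ + q) * N)         ≡⟨ res-unique (q′ + q) (res<modulus x) ⟩
    res n x                                  ∎
    where
    open ≡-Reasoning
    N = modulusℤ n
    q′ = x ℤ./ℕ modulus n
    regroup : ∀ s a b m → (s + a * m) + b * m ≡ s + (a + b) * m
    regroup = solve-∀

  res-periodic : ∀ x → res n (x + modulusℤ n) ≡ res n x
  res-periodic x =
    trans (cong (λ y → res n (x + y)) (sym (ℤₚ.*-identityˡ (modulusℤ n)))) (res-+-multiple x (+ 1))

  res-neg : ∀ x → res n (- x) ≡ (modulus n ℕ.∸ res n x) ℕ.% modulus n
  res-neg x = begin
    res n (- x)                                ≡⟨ cong (λ y → res n (- y)) (res-decomposition x) ⟩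
    res n (- (+ r + q * N))                    ≡⟨ cong (res n) (negate (+ r) q N) ⟩
    res n ((N - + r) + (- q - + 1) * N)        ≡⟨ cong (λ y → res n (y + (- q - + 1) * N)) N-r≡N∸r ⟩
    res n (+ (modulus n ℕ.∸ r) + (- q - + 1) * N) ≡⟨ res-+-multiple (+ (modulus n ℕ.∸ r)) (- q - + 1) ⟩
    res n (+ (modulus n ℕ.∸ r))                ∎
    where
    open ≡-Reasoning
    N = modulusℤ n
    r = res n x
    q = x ℤ./ℕ modulus n
    negate : ∀ s a m → - (s + a * m) ≡ (m - s) + (- a - + 1) * m
    negate = solve-∀
    N-r≡N∸r : N - + r ≡ + (modulus n ℕ.∸ r)
    N-r≡N∸r = trans (ℤₚ.m-n≡m⊖n (modulus n) r) (ℤₚ.⊖-≥ (ℕₚ.<⇒≤ (res<modulus x)))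

  OddOnResidues : (ℕ → ℤ) → Set
  OddOnResidues f =
    f 0 ≡ + 0 × (∀ r → 0 < r → r < modulus n → f (modulus n ℕ.∸ r) ≡ - f r)

  residue-odd : ∀ {f} → OddOnResidues f → ∀ x → f (res n (- x)) ≡ - f (res n x)
  residue-odd {f} (f0≡0 , f-reflect) x = trans (cong f (res-neg x)) (reflect (res n x) (res<modulus x))
    where
    reflect : ∀ r → r < modulus n → f ((modulus n ℕ.∸ r) ℕ.% modulus n) ≡ - f r
    reflect zero    _   = trans (cong f (n%n≡0 (modulus n))) (trans f0≡0 (cong -_ (sym f0≡0)))
    reflect (suc r) r<N = trans (cong f (m<n⇒m%n≡m (ℕₚ.∸-monoʳ-< {o = 0} (s≤s z≤n) (ℕₚ.<⇒≤ r<N))))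
                                (f-reflect (suc r) (s≤s z≤n) r<N)

residueSign : (n k r : ℕ) → ℤ
residueSign n k r =
  if (r ≤ᵇ k) ∨ (modulus n ℕ.∸ k ≤ᵇ r) then + 0
  else if r ≤ᵇ n then + 1
  else - + 1

module _ (n k : ℕ) (k<n : k < n) where

  private
    N = modulus n
    k≤N : k ≤ N
    k≤N = ℕₚ.≤-trans (ℕₚ.<⇒≤ k<n) (ℕₚ.m≤n⇒m≤1+n (ℕₚ.m≤m+n n _))
    n<N∸k : n < N ℕ.∸ k
    n<N∸k = subst (_≤ N ℕ.∸ k) (modulus∸n n) (ℕₚ.∸-monoʳ-≤ N (ℕₚ.<⇒≤ k<n))

  residueSign-zero : ∀ {r} → r ≤ k ⊎ N ℕ.∸ k ≤ r → residueSign n k r ≡ + 0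
  residueSign-zero (inj₁ r≤k) rewrite ≤⇒≤ᵇ-true r≤k = refl
  residueSign-zero {r} (inj₂ N∸k≤r) rewrite ≤⇒≤ᵇ-true N∸k≤r | ∨-zeroʳ (r ≤ᵇ k) = refl

  residueSign-pos : ∀ {r} → k < r → r ≤ n → residueSign n k r ≡ + 1
  residueSign-pos k<r r≤n
    rewrite ≰⇒≤ᵇ-false (ℕₚ.<⇒≱ k<r)
          | ≰⇒≤ᵇ-false (ℕₚ.<⇒≱ (ℕₚ.≤-<-trans r≤n n<N∸k))
          | ≤⇒≤ᵇ-true r≤n = refl

  residueSign-neg : ∀ {r} → k < r → r < N ℕ.∸ k → n < r → residueSign n k r ≡ - + 1
  residueSign-neg k<r r<N∸k n<r
    rewrite ≰⇒≤ᵇ-false (ℕₚ.<⇒≱ k<r)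
          | ≰⇒≤ᵇ-false (ℕₚ.<⇒≱ r<N∸k)
          | ≰⇒≤ᵇ-false (ℕₚ.<⇒≱ n<r) = refl

  residueSign-odd : OddOnResidues n (residueSign n k)
  residueSign-odd = residueSign-zero (inj₁ z≤n) , reflect
    where
    reflect : ∀ r → 0 < r → r < N → residueSign n k (N ℕ.∸ r) ≡ - residueSign n k r
    reflect r _ r<N with r ≤? k | N ℕ.∸ k ≤? r
    ... | yes r≤k | _ = trans (residueSign-zero (inj₂ (ℕₚ.∸-monoʳ-≤ N r≤k)))
                              (cong -_ (sym (residueSign-zero (inj₁ r≤k))))
    ... | no _ | yes N∸k≤r = trans (residueSign-zero (inj₁ (∸-reflect-≤ k≤N N∸k≤r)))
                                   (cong -_ (sym (residueSign-zero (inj₂ N∸k≤r))))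
    ... | no r≰k | no N∸k≰r with r ≤? n
    ...   | yes r≤n = trans (residueSign-neg (∸-reflect-< (ℕₚ.<⇒≤ r<N) (ℕₚ.≰⇒> N∸k≰r))
                                            (ℕₚ.∸-monoʳ-< (ℕₚ.≰⇒> r≰k) (ℕₚ.<⇒≤ r<N))
                                            (subst (_≤ N ℕ.∸ r) (modulus∸n n) (ℕₚ.∸-monoʳ-≤ N r≤n)))
                            (cong -_ (sym (residueSign-pos (ℕₚ.≰⇒> r≰k) r≤n)))
    ...   | no r≰n = trans (residueSign-pos (∸-reflect-< (ℕₚ.<⇒≤ r<N) (ℕₚ.≰⇒> N∸k≰r))
                                            (subst (N ℕ.∸ r ≤_) (modulus∸1+n n) (ℕₚ.∸-monoʳ-≤ N (ℕₚ.≰⇒> r≰n))))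
                           (cong -_ (sym (residueSign-neg (ℕₚ.≰⇒> r≰k) (ℕₚ.≰⇒> N∸k≰r) (ℕₚ.≰⇒> r≰n))))

  eps-odd : ∀ t → eps n k (- t) ≡ - eps n k t
  eps-odd = residue-odd n residueSign-odd

eps-periodic : ∀ n k t → eps n k (t + modulusℤ n) ≡ eps n k t
eps-periodic n k t = cong (residueSign n k) (res-periodic n t)

displacement : (n i : ℕ) → ℕ → ℤ
displacement n i r with i ≡ᵇ 0 | i ≡ᵇ n
... | true  | _     = if r ≡ᵇ 1 then - + 2 else if r ≡ᵇ 2 ℕ.* n then + 2 else + 0
... | false | true  = if r ≡ᵇ n then + 1 else if r ≡ᵇ suc n then - + 1 else + 0
... | false | false =
  if r ≡ᵇ i then + 1 else if r ≡ᵇ suc i then - + 1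
  else if r ≡ᵇ modulus n ℕ.∸ i then - + 1
  else if r ≡ᵇ modulus n ℕ.∸ suc i then + 1 else + 0

Odd : (ℤ → ℤ) → Set
Odd f = ∀ x → f (- x) ≡ - f x

Equivariant : ℕ → (ℤ → ℤ) → Set
Equivariant n f = ∀ x → f (x + modulusℤ n) ≡ f x + modulusℤ n

if-+ : ∀ b x {c d y} → y ≡ x + d → (if b then x + c else y) ≡ x + (if b then c else d)
if-+ true  _ _ = refl
if-+ false _ y≡x+d = y≡x+d

genAct≡+displacement : ∀ n i x → genAct n i x ≡ x + displacement n i (res n x)
genAct≡+displacement n i x with i ≡ᵇ 0 | i ≡ᵇ n
... | true | _ =
  if-+ (r ≡ᵇ 1) x (if-+ (r ≡ᵇ 2 ℕ.* n) x x≡x+0)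
  where r = res n x ; x≡x+0 = sym (ℤₚ.+-identityʳ x)
... | false | true =
  if-+ (r ≡ᵇ n) x (if-+ (r ≡ᵇ suc n) x x≡x+0)
  where r = res n x ; x≡x+0 = sym (ℤₚ.+-identityʳ x)
... | false | false =
  if-+ (r ≡ᵇ i) x (if-+ (r ≡ᵇ suc i) x (if-+ (r ≡ᵇ modulus n ℕ.∸ i) x
    (if-+ (r ≡ᵇ modulus n ℕ.∸ suc i) x x≡x+0)))
  where r = res n x ; x≡x+0 = sym (ℤₚ.+-identityʳ x)

module _ (n i : ℕ) where

  private
    d = displacement n i

  genAct-residue : ∀ {r} → r < modulus n → genAct n i (+ r) ≡ + r + d r
  genAct-residue {r} r<N = trans (genAct≡+displacement n i (+ r)) (cong (λ s → + r + d s) (res-residue n r<N))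

  genAct-fixed-residue : ∀ {r} → r < modulus n → d r ≡ + 0 → genAct n i (+ r) ≡ + r
  genAct-fixed-residue {r} r<N dr≡0 =
    trans (genAct-residue r<N) (trans (cong (λ t → + r + t) dr≡0) (ℤₚ.+-identityʳ (+ r)))

  genAct-equivariant : Equivariant n (genAct n i)
  genAct-equivariant x = begin
    genAct n i (x + modulusℤ n)                  ≡⟨ genAct≡+displacement n i _ ⟩
    (x + modulusℤ n) + d (res n (x + modulusℤ n)) ≡⟨ cong (λ s → (x + modulusℤ n) + d s) (res-periodic n x) ⟩
    (x + modulusℤ n) + d (res n x)                ≡⟨ swap x (modulusℤ n) (d (res n x)) ⟩
    (x + d (res n x)) + modulusℤ n                ≡⟨ cong (_+ modulusℤ n) (genAct≡+displacement n i x) ⟨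
    genAct n i x + modulusℤ n                     ∎
    where
    open ≡-Reasoning
    swap : ∀ a b c → (a + b) + c ≡ (a + c) + b
    swap = solve-∀

  residues-odd⇒genAct-odd : OddOnResidues n d → Odd (genAct n i)
  residues-odd⇒genAct-odd d-odd x = begin
    genAct n i (- x)              ≡⟨ genAct≡+displacement n i (- x) ⟩
    - x + d (res n (- x))         ≡⟨ cong (λ t → - x + t) (residue-odd n d-odd x) ⟩
    - x + - d (res n x)           ≡⟨ ℤₚ.neg-distrib-+ x _ ⟨
    - (x + d (res n x))           ≡⟨ cong -_ (genAct≡+displacement n i x) ⟨
    - genAct n i x                ∎
    where open ≡-Reasoning

  InvolutiveOnResidues : Set
  InvolutiveOnResidues = ∀ r → r < modulus n → d (res n (+ r + d r)) ≡ - d r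

  residue-moved-involutive : ∀ {r s} → s < modulus n → + r + d r ≡ + s → d s ≡ - d r →
                             d (res n (+ r + d r)) ≡ - d r
  residue-moved-involutive s<N r+dr≡s ds≡-dr = trans (cong (λ y → d (res n y)) r+dr≡s)
                                                  (trans (cong d (res-residue n s<N)) ds≡-dr)

  residue-fixed-involutive : ∀ {r} → r < modulus n → d r ≡ + 0 → d (res n (+ r + d r)) ≡ - d r
  residue-fixed-involutive {r} r<N dr≡0 = residue-moved-involutive r<N
    (trans (cong (λ t → + r + t) dr≡0) (ℤₚ.+-identityʳ (+ r))) (trans dr≡0 (cong -_ (sym dr≡0)))

  residues-involutive⇒genAct-involutive : InvolutiveOnResidues → ∀ x → genAct n i (genAct n i x) ≡ x
  residues-involutive⇒genAct-involutive d-inv x = begin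
    genAct n i (genAct n i x)               ≡⟨ genAct≡+displacement n i _ ⟩
    genAct n i x + d (res n (genAct n i x)) ≡⟨ cong₂ (λ y s → y + d s) (genAct≡+displacement n i x) res-genAct ⟩
    (x + d r) + d (res n (+ r + d r))       ≡⟨ cong (λ t → (x + d r) + t) (d-inv r (res<modulus n x)) ⟩
    (x + d r) + - d r                       ≡⟨ cancel x (d r) ⟩
    x                                       ∎
    where
    open ≡-Reasoning
    r = res n x
    q = x ℤ./ℕ modulus n
    cancel : ∀ a b → (a + b) + - b ≡ a
    cancel = solve-∀
    regroup : ∀ a b c m → (a + b * m) + c ≡ (a + c) + b * m
    regroup = solve-∀
    res-genAct : res n (genAct n i x) ≡ res n (+ r + d r)
    res-genAct = begin
      res n (genAct n i x)                   ≡⟨ cong (res n) (genAct≡+displacement n i x) ⟩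
      res n (x + d r)                        ≡⟨ cong (λ y → res n (y + d r)) (res-decomposition n x) ⟩
      res n ((+ r + q * modulusℤ n) + d r)  ≡⟨ cong (res n) (regroup (+ r) q (d r) (modulusℤ n)) ⟩
      res n ((+ r + d r) + q * modulusℤ n)  ≡⟨ res-+-multiple n (+ r + d r) q ⟩
      res n (+ r + d r)                      ∎

module FirstGenerator (n : ℕ) (0<n : 0 < n) where

  private
    N = modulus n
    d = displacement n 0
    1<2n : 1 < 2 ℕ.* n
    1<2n = ℕₚ.*-monoʳ-≤ 2 0<n
    1<N : 1 < N
    1<N = s≤s (ℕₚ.<⇒≤ 1<2n)
    n<2n : n < 2 ℕ.* n
    n<2n = ℕₚ.m<m+n n (ℕₚ.<-≤-trans 0<n (ℕₚ.m≤m+n n 0))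

  displacement-1 : d 1 ≡ - + 2
  displacement-1 = refl

  displacement-2n : d (2 ℕ.* n) ≡ + 2
  displacement-2n rewrite ≢⇒≡ᵇ-false (ℕₚ.>⇒≢ 1<2n) | ≡ᵇ-refl (2 ℕ.* n) = refl

  displacement-other : ∀ {r} → r ≢ 1 → r ≢ 2 ℕ.* n → d r ≡ + 0
  displacement-other r≢1 r≢2n rewrite ≢⇒≡ᵇ-false r≢1 | ≢⇒≡ᵇ-false r≢2n = refl

  odd : OddOnResidues n d
  odd = displacement-other (λ ()) (ℕₚ.<⇒≢ (ℕₚ.<-trans (s≤s z≤n) 1<2n)) , reflect
    where
    reflect : ∀ r → 0 < r → r < N → d (N ℕ.∸ r) ≡ - d r
    reflect r _ r<N with r ≟ 1 | r ≟ 2 ℕ.* n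
    ... | yes refl | _ = displacement-2n
    ... | no _ | yes refl = trans (cong d modulus∸2n) (trans displacement-1 (cong -_ (sym displacement-2n)))
      where modulus∸2n : N ℕ.∸ 2 ℕ.* n ≡ 1
            modulus∸2n = ℕₚ.m+n∸n≡m 1 (2 ℕ.* n)
    ... | no r≢1 | no r≢2n =
      trans (displacement-other (λ N∸r≡1 → r≢2n (∸-flip (ℕₚ.<⇒≤ r<N) N∸r≡1))
                                (λ N∸r≡2n → r≢1 (trans (∸-flip (ℕₚ.<⇒≤ r<N) N∸r≡2n) (ℕₚ.m+n∸n≡m 1 (2 ℕ.* n)))))
            (cong -_ (sym (displacement-other r≢1 r≢2n)))

  involutive : InvolutiveOnResidues n 0
  involutive r r<N with r ≟ 1 | r ≟ 2 ℕ.* n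
  ... | yes refl | _ = trans (cong d res-minus-1) displacement-2n
    where res-minus-1 : res n (- + 1) ≡ 2 ℕ.* n
          res-minus-1 = trans (res-neg n (+ 1)) (trans (cong (λ r → (N ℕ.∸ r) ℕ.% N) (res-residue n 1<N))
                                                      (res-residue n (ℕₚ.n<1+n (2 ℕ.* n))))
  ... | no _ | yes refl = trans (cong (λ t → d (res n (+ (2 ℕ.* n) + t))) displacement-2n)
                             (trans (cong d res-2n+2) (trans displacement-1 (cong -_ (sym displacement-2n))))
    where wrap : ∀ m → m + + 2 ≡ + 1 + + 1 * (+ 1 + m)
          wrap = solve-∀
          res-2n+2 : res n (+ (2 ℕ.* n) + + 2) ≡ 1
          res-2n+2 = trans (cong (res n) (wrap (+ (2 ℕ.* n)))) (res-unique n (+ 1) 1<N)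
  ... | no r≢1 | no r≢2n = residue-fixed-involutive n 0 r<N (displacement-other r≢1 r≢2n)

  genAct-1 : genAct n 0 (+ 1) ≡ - + 1
  genAct-1 = genAct-residue n 0 1<N

  genAct-fixed : ∀ {j} → 1 < j → j ≤ n → genAct n 0 (+ j) ≡ + j
  genAct-fixed 1<j j≤n = genAct-fixed-residue n 0 (window<modulus j≤n)
    (displacement-other (ℕₚ.>⇒≢ 1<j) (ℕₚ.<⇒≢ (ℕₚ.≤-<-trans j≤n n<2n)))

module LastGenerator (n : ℕ) (0<n : 0 < n) where

  private
    N = modulus n
    d = displacement n n
    n<N : n < N
    n<N = window<modulus ℕₚ.≤-refl
    1+n<N : suc n < N
    1+n<N = subst (suc n <_) (sym (modulus≡1+n+n n)) (ℕₚ.m<m+n (suc n) 0<n)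

  displacement-n : d n ≡ + 1
  displacement-n rewrite ≢⇒≡ᵇ-false (ℕₚ.>⇒≢ 0<n) | ≡ᵇ-refl n | ≡ᵇ-refl n = refl

  displacement-1+n : d (suc n) ≡ - + 1
  displacement-1+n rewrite ≢⇒≡ᵇ-false (ℕₚ.>⇒≢ 0<n) | ≡ᵇ-refl n
                         | ≢⇒≡ᵇ-false (ℕₚ.>⇒≢ (ℕₚ.n<1+n n)) | ≡ᵇ-refl n = refl

  displacement-other : ∀ {r} → r ≢ n → r ≢ suc n → d r ≡ + 0
  displacement-other r≢n r≢1+n rewrite ≢⇒≡ᵇ-false (ℕₚ.>⇒≢ 0<n) | ≡ᵇ-refl n
                                     | ≢⇒≡ᵇ-false r≢n | ≢⇒≡ᵇ-false r≢1+n = refl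

  odd : OddOnResidues n d
  odd = displacement-other (ℕₚ.<⇒≢ 0<n) (λ ()) , reflect
    where
    reflect : ∀ r → 0 < r → r < N → d (N ℕ.∸ r) ≡ - d r
    reflect r _ r<N with r ≟ n | r ≟ suc n
    ... | yes refl | _ =
      trans (cong d (modulus∸n n)) (trans displacement-1+n (cong -_ (sym displacement-n)))
    ... | no _ | yes refl =
      trans (cong d (modulus∸1+n n)) (trans displacement-n (cong -_ (sym displacement-1+n)))
    ... | no r≢n | no r≢1+n =
      trans (displacement-other (λ N∸r≡n → r≢1+n (trans (∸-flip (ℕₚ.<⇒≤ r<N) N∸r≡n) (modulus∸n n)))
                                (λ N∸r≡1+n → r≢n (trans (∸-flip (ℕₚ.<⇒≤ r<N) N∸r≡1+n) (modulus∸1+n n))))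
            (cong -_ (sym (displacement-other r≢n r≢1+n)))

  involutive : InvolutiveOnResidues n n
  involutive r r<N with r ≟ n | r ≟ suc n
  ... | yes refl | _ = residue-moved-involutive n n 1+n<N n+1≡1+n
                         (trans displacement-1+n (cong -_ (sym displacement-n)))
    where n+1≡1+n : + n + d n ≡ + suc n
          n+1≡1+n = trans (cong (λ t → + n + t) displacement-n) (ℤₚ.+-comm (+ n) (+ 1))
  ... | no _ | yes refl = residue-moved-involutive n n n<N 1+n-1≡n
                            (trans displacement-n (cong -_ (sym displacement-1+n)))
    where 1+n-1≡n : + suc n + d (suc n) ≡ + n
          1+n-1≡n = trans (cong (λ t → + suc n + t) displacement-1+n) (ℤₚ.[1+m]⊖[1+n]≡m⊖n n 0)
  ... | no r≢n | no r≢1+n = residue-fixed-involutive n n r<N (displacement-other r≢n r≢1+n)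

  genAct-n : genAct n n (+ n) ≡ - + n + modulusℤ n
  genAct-n = begin
    genAct n n (+ n)          ≡⟨ genAct-residue n n n<N ⟩
    + n + d n                 ≡⟨ cong (λ t → + n + t) displacement-n ⟩
    + n + + 1                 ≡⟨ reflect (+ n) ⟩
    - + n + (+ suc n + + n)   ≡⟨ cong (λ t → - + n + t) (ℤₚ.pos-+ (suc n) n) ⟨
    - + n + + (suc n ℕ.+ n)   ≡⟨ cong (λ t → - + n + + t) (modulus≡1+n+n n) ⟨
    - + n + modulusℤ n        ∎
    where
    open ≡-Reasoning
    reflect : ∀ m → m + + 1 ≡ - m + ((+ 1 + m) + m)
    reflect = solve-∀

  module _ (p : State) where

    rhoGen-n : proj₁ (rhoGen n n p) n ≡ - proj₁ p n
    rhoGen-n rewrite ≢⇒≡ᵇ-false (ℕₚ.>⇒≢ 0<n) | ≡ᵇ-refl n | ≡ᵇ-refl n = refl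

    rhoGen-other : ∀ {j} → j ≢ n → proj₁ (rhoGen n n p) j ≡ proj₁ p j
    rhoGen-other j≢n rewrite ≢⇒≡ᵇ-false (ℕₚ.>⇒≢ 0<n) | ≡ᵇ-refl n | ≢⇒≡ᵇ-false j≢n = refl

    rhoGen-height : proj₂ (rhoGen n n p) ≡ proj₂ p + proj₁ p n
    rhoGen-height rewrite ≢⇒≡ᵇ-false (ℕₚ.>⇒≢ 0<n) | ≡ᵇ-refl n = refl

  genAct-fixed : ∀ {j} → j < n → genAct n n (+ j) ≡ + j
  genAct-fixed j<n = genAct-fixed-residue n n (window<modulus (ℕₚ.<⇒≤ j<n))
    (displacement-other (ℕₚ.<⇒≢ j<n) (ℕₚ.<⇒≢ (ℕₚ.m<n⇒m<1+n j<n)))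

module MiddleGenerator (n i : ℕ) (0<i : 0 < i) (i<n : i < n) where

  -- i′ and i′-1 are the residues of −i and −(i+1).
  private
    N = modulus n
    d = displacement n i
    i′ = N ℕ.∸ i
    i′-1 = N ℕ.∸ suc i
    n<i′-1 : n < i′-1
    n<i′-1 = subst (_≤ i′-1) (modulus∸n n) (ℕₚ.∸-monoʳ-≤ N i<n)
    i′≡1+i′-1 : i′ ≡ suc i′-1
    i′≡1+i′-1 = ℕₚ.+-∸-assoc 1 (ℕₚ.<⇒≤ (window<modulus i<n))
    i≤N : i ≤ N
    i≤N = ℕₚ.<⇒≤ (window<modulus (ℕₚ.<⇒≤ i<n))
    1+i≤N : suc i ≤ N
    1+i≤N = ℕₚ.<⇒≤ (window<modulus i<n)
    i<i′-1 : i < i′-1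
    i<i′-1 = ℕₚ.<-trans i<n n<i′-1
    1+i<i′-1 : suc i < i′-1
    1+i<i′-1 = ℕₚ.≤-<-trans i<n n<i′-1
    i′-1<i′ : i′-1 < i′
    i′-1<i′ = subst (i′-1 <_) (sym i′≡1+i′-1) (ℕₚ.n<1+n i′-1)
    i′<N : i′ < N
    i′<N = ℕₚ.∸-monoʳ-< {o = 0} 0<i i≤N

  displacement-i : d i ≡ + 1
  displacement-i rewrite ≢⇒≡ᵇ-false (ℕₚ.>⇒≢ 0<i) | ≢⇒≡ᵇ-false (ℕₚ.<⇒≢ i<n) | ≡ᵇ-refl i = refl

  displacement-1+i : d (suc i) ≡ - + 1
  displacement-1+i rewrite ≢⇒≡ᵇ-false (ℕₚ.>⇒≢ 0<i) | ≢⇒≡ᵇ-false (ℕₚ.<⇒≢ i<n)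
                         | ≢⇒≡ᵇ-false (ℕₚ.>⇒≢ (ℕₚ.n<1+n i)) | ≡ᵇ-refl (suc i) = refl

  displacement-i′ : d i′ ≡ - + 1
  displacement-i′ rewrite ≢⇒≡ᵇ-false (ℕₚ.>⇒≢ 0<i) | ≢⇒≡ᵇ-false (ℕₚ.<⇒≢ i<n)
                        | ≢⇒≡ᵇ-false (ℕₚ.>⇒≢ (ℕₚ.<-trans i<i′-1 i′-1<i′))
                        | ≢⇒≡ᵇ-false (ℕₚ.>⇒≢ (ℕₚ.<-trans 1+i<i′-1 i′-1<i′)) | ≡ᵇ-refl i′ = refl

  displacement-i′-1 : d i′-1 ≡ + 1
  displacement-i′-1 rewrite ≢⇒≡ᵇ-false (ℕₚ.>⇒≢ 0<i) | ≢⇒≡ᵇ-false (ℕₚ.<⇒≢ i<n)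
                          | ≢⇒≡ᵇ-false (ℕₚ.>⇒≢ i<i′-1) | ≢⇒≡ᵇ-false (ℕₚ.>⇒≢ 1+i<i′-1)
                          | ≢⇒≡ᵇ-false (ℕₚ.<⇒≢ i′-1<i′) | ≡ᵇ-refl i′-1 = refl

  displacement-other : ∀ {r} → r ≢ i → r ≢ suc i → r ≢ i′ → r ≢ i′-1 → d r ≡ + 0
  displacement-other r≢i r≢1+i r≢i′ r≢i′-1
    rewrite ≢⇒≡ᵇ-false (ℕₚ.>⇒≢ 0<i) | ≢⇒≡ᵇ-false (ℕₚ.<⇒≢ i<n)
          | ≢⇒≡ᵇ-false r≢i | ≢⇒≡ᵇ-false r≢1+i | ≢⇒≡ᵇ-false r≢i′ | ≢⇒≡ᵇ-false r≢i′-1 = refl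

  odd : OddOnResidues n d
  odd = displacement-other (ℕₚ.<⇒≢ 0<i) (λ ()) (ℕₚ.<⇒≢ (ℕₚ.≤-<-trans z≤n (ℕₚ.<-trans i<i′-1 i′-1<i′)))
                           (ℕₚ.<⇒≢ (ℕₚ.≤-<-trans z≤n i<i′-1)) , reflect
    where
    reflect : ∀ r → 0 < r → r < N → d (N ℕ.∸ r) ≡ - d r
    reflect r _ r<N with r ≟ i | r ≟ suc i | r ≟ i′ | r ≟ i′-1
    ... | yes refl | _ | _ | _ = trans displacement-i′ (cong -_ (sym displacement-i))
    ... | no _ | yes refl | _ | _ = trans displacement-i′-1 (cong -_ (sym displacement-1+i))
    ... | no _ | no _ | yes refl | _ =
      trans (cong d (ℕₚ.m∸[m∸n]≡n i≤N)) (trans displacement-i (cong -_ (sym displacement-i′)))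
    ... | no _ | no _ | no _ | yes refl =
      trans (cong d (ℕₚ.m∸[m∸n]≡n 1+i≤N)) (trans displacement-1+i (cong -_ (sym displacement-i′-1)))
    ... | no r≢i | no r≢1+i | no r≢i′ | no r≢i′-1 =
      trans (displacement-other (λ e → r≢i′ (flip e)) (λ e → r≢i′-1 (flip e))
                                (λ e → r≢i (trans (flip e) (ℕₚ.m∸[m∸n]≡n i≤N)))
                                (λ e → r≢1+i (trans (flip e) (ℕₚ.m∸[m∸n]≡n 1+i≤N))))
            (cong -_ (sym (displacement-other r≢i r≢1+i r≢i′ r≢i′-1)))
      where flip : ∀ {s} → N ℕ.∸ r ≡ s → r ≡ N ℕ.∸ s
            flip = ∸-flip (ℕₚ.<⇒≤ r<N)

  involutive : InvolutiveOnResidues n i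
  involutive r r<N with r ≟ i | r ≟ suc i | r ≟ i′ | r ≟ i′-1
  ... | yes refl | _ | _ | _ =
    residue-moved-involutive n i (window<modulus i<n)
      (trans (cong (λ t → + i + t) displacement-i) (ℤₚ.+-comm (+ i) (+ 1)))
      (trans displacement-1+i (cong -_ (sym displacement-i)))
  ... | no _ | yes refl | _ | _ =
    residue-moved-involutive n i (window<modulus (ℕₚ.<⇒≤ i<n))
      (trans (cong (λ t → + suc i + t) displacement-1+i) (ℤₚ.[1+m]⊖[1+n]≡m⊖n i 0))
      (trans displacement-i (cong -_ (sym displacement-1+i)))
  ... | no _ | no _ | yes refl | _ =
    residue-moved-involutive n i (ℕₚ.<-trans i′-1<i′ i′<N)
      (trans (cong (λ t → + i′ + t) displacement-i′)
             (trans (cong (λ t → + t + - + 1) i′≡1+i′-1) (ℤₚ.[1+m]⊖[1+n]≡m⊖n i′-1 0)))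
      (trans displacement-i′-1 (cong -_ (sym displacement-i′)))
  ... | no _ | no _ | no _ | yes refl =
    residue-moved-involutive n i i′<N
      (trans (cong (λ t → + i′-1 + t) displacement-i′-1)
             (trans (ℤₚ.+-comm (+ i′-1) (+ 1)) (cong +_ (sym i′≡1+i′-1))))
      (trans displacement-i′ (cong -_ (sym displacement-i′-1)))
  ... | no r≢i | no r≢1+i | no r≢i′ | no r≢i′-1 =
    residue-fixed-involutive n i r<N (displacement-other r≢i r≢1+i r≢i′ r≢i′-1)

  module _ (p : State) where

    private
      i-generic : (i ≡ᵇ 0) ≡ false × (i ≡ᵇ n) ≡ false
      i-generic = ≢⇒≡ᵇ-false (ℕₚ.>⇒≢ 0<i) , ≢⇒≡ᵇ-false (ℕₚ.<⇒≢ i<n)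

    rhoGen-i : proj₁ (rhoGen n i p) i ≡ proj₁ p (suc i)
    rhoGen-i rewrite proj₁ i-generic | proj₂ i-generic | ≡ᵇ-refl i = refl

    rhoGen-1+i : proj₁ (rhoGen n i p) (suc i) ≡ proj₁ p i
    rhoGen-1+i rewrite proj₁ i-generic | proj₂ i-generic
                     | ≢⇒≡ᵇ-false (ℕₚ.>⇒≢ (ℕₚ.n<1+n i)) | ≡ᵇ-refl (suc i) = refl

    rhoGen-other : ∀ {j} → j ≢ i → j ≢ suc i → proj₁ (rhoGen n i p) j ≡ proj₁ p j
    rhoGen-other j≢i j≢1+i rewrite proj₁ i-generic | proj₂ i-generic
                                 | ≢⇒≡ᵇ-false j≢i | ≢⇒≡ᵇ-false j≢1+i = refl

    rhoGen-height : proj₂ (rhoGen n i p) ≡ proj₂ p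
    rhoGen-height rewrite proj₁ i-generic | proj₂ i-generic = refl

  genAct-i : genAct n i (+ i) ≡ + suc i
  genAct-i = trans (genAct-residue n i (window<modulus (ℕₚ.<⇒≤ i<n)))
                   (trans (cong (λ t → + i + t) displacement-i) (ℤₚ.+-comm (+ i) (+ 1)))

  genAct-1+i : genAct n i (+ suc i) ≡ + i
  genAct-1+i = trans (genAct-residue n i (window<modulus i<n))
                     (trans (cong (λ t → + suc i + t) displacement-1+i) (ℤₚ.[1+m]⊖[1+n]≡m⊖n i 0))

  genAct-fixed : ∀ {j} → j ≤ n → j ≢ i → j ≢ suc i → genAct n i (+ j) ≡ + j
  genAct-fixed j≤n j≢i j≢1+i = genAct-fixed-residue n i (window<modulus j≤n)
    (displacement-other j≢i j≢1+i (ℕₚ.<⇒≢ (ℕₚ.<-trans j<i′-1 i′-1<i′)) (ℕₚ.<⇒≢ j<i′-1))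
    where j<i′-1 = ℕₚ.≤-<-trans j≤n n<i′-1

data Generator (n : ℕ) : ℕ → Set where
  first  : Generator n 0
  last   : Generator n n
  middle : ∀ {i} → 0 < i → i < n → Generator n i

generator : ∀ {n i} → i ≤ n → Generator n i
generator {i = zero} _ = first
generator {n} {suc i} i≤n with suc i ≟ n
... | yes refl = last
... | no i≢n   = middle (s≤s z≤n) (ℕₚ.≤∧≢⇒< i≤n i≢n)

module _ {n : ℕ} (0<n : 0 < n) where

  genAct-odd : ∀ {i} → i ≤ n → Odd (genAct n i)
  genAct-odd {i} i≤n with generator i≤n
  ... | first          = residues-odd⇒genAct-odd n 0 (FirstGenerator.odd n 0<n)
  ... | last           = residues-odd⇒genAct-odd n n (LastGenerator.odd n 0<n)
  ... | middle 0<i i<n = residues-odd⇒genAct-odd n i (MiddleGenerator.odd n i 0<i i<n)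

  genAct-involutive : ∀ {i} → i ≤ n → ∀ x → genAct n i (genAct n i x) ≡ x
  genAct-involutive {i} i≤n with generator i≤n
  ... | first          = residues-involutive⇒genAct-involutive n 0 (FirstGenerator.involutive n 0<n)
  ... | last           = residues-involutive⇒genAct-involutive n n (LastGenerator.involutive n 0<n)
  ... | middle 0<i i<n = residues-involutive⇒genAct-involutive n i (MiddleGenerator.involutive n i 0<i i<n)

  genAct-injective : ∀ {i} → i ≤ n → ∀ {x y} → genAct n i x ≡ genAct n i y → x ≡ y
  genAct-injective {i} i≤n {x} {y} gx≡gy =
    trans (sym (genAct-involutive i≤n x)) (trans (cong (genAct n i) gx≡gy) (genAct-involutive i≤n y))

  act-odd : ∀ w → Odd (act n w)
  act-odd []      x = refl
  act-odd (i ∷ w) x = trans (cong (genAct n (toℕ i)) (act-odd w x)) (genAct-odd (toℕ≤pred[n] i) _)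

  act-equivariant : ∀ w → Equivariant n (act n w)
  act-equivariant []      x = refl
  act-equivariant (i ∷ w) x =
    trans (cong (genAct n (toℕ i)) (act-equivariant w x)) (genAct-equivariant n (toℕ i) _)

  act-injective : ∀ w {x y} → act n w x ≡ act n w y → x ≡ y
  act-injective []      eq = eq
  act-injective (i ∷ w) eq = act-injective w (genAct-injective (toℕ≤pred[n] i) eq)

module _ {f U : ℤ → ℤ} (f-injective : ∀ {x y} → f x ≡ f y → x ≡ y) (f∘U≗id : ∀ x → f (U x) ≡ x) where

  right-inverse-odd : Odd f → Odd U
  right-inverse-odd f-odd x =
    f-injective (trans (f∘U≗id (- x)) (sym (trans (f-odd (U x)) (cong -_ (f∘U≗id x)))))

  right-inverse-equivariant : ∀ {n} → Equivariant n f → Equivariant n U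
  right-inverse-equivariant {n} f-equivariant x =
    f-injective (trans (f∘U≗id _) (sym (trans (f-equivariant (U x)) (cong (_+ modulusℤ n) (f∘U≗id x)))))

sumTo-cong : ∀ m {f g : ℕ → ℤ} → (∀ j → 1 ≤ j → j ≤ m → f j ≡ g j) → sumTo m f ≡ sumTo m g
sumTo-cong zero    f≗g = refl
sumTo-cong (suc m) f≗g =
  cong₂ _+_ (sumTo-cong m (λ j 1≤j j≤m → f≗g j 1≤j (ℕₚ.m≤n⇒m≤1+n j≤m))) (f≗g (suc m) (s≤s z≤n) ℕₚ.≤-refl)

sumTo-update : ∀ {m j} (f g : ℕ → ℤ) → 1 ≤ j → j ≤ m →
               (∀ l → 1 ≤ l → l ≤ m → l ≢ j → g l ≡ f l) →
               sumTo m g ≡ sumTo m f + (g j - f j)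
sumTo-update {zero} _ _ (s≤s _) ()
sumTo-update {suc m} {j} f g 1≤j j≤1+m g≗f with j ≟ suc m
... | yes refl = begin
  sumTo m g + g (suc m)                          ≡⟨ cong (_+ g (suc m)) (sumTo-cong m lower) ⟩
  sumTo m f + g (suc m)                          ≡⟨ regroup (sumTo m f) (f (suc m)) (g (suc m)) ⟩
  sumTo m f + f (suc m) + (g (suc m) - f (suc m)) ∎
  where
  open ≡-Reasoning
  regroup : ∀ s a b → s + b ≡ s + a + (b - a)
  regroup = solve-∀
  lower : ∀ l → 1 ≤ l → l ≤ m → g l ≡ f l
  lower l 1≤l l≤m = g≗f l 1≤l (ℕₚ.m≤n⇒m≤1+n l≤m) (ℕₚ.<⇒≢ (s≤s l≤m))
... | no j≢1+m = begin
  sumTo m g + g (suc m)                   ≡⟨ cong₂ _+_ (sumTo-update f g 1≤j j≤m lower) top ⟩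
  sumTo m f + (g j - f j) + f (suc m)     ≡⟨ regroup (sumTo m f) (g j - f j) (f (suc m)) ⟩
  sumTo m f + f (suc m) + (g j - f j)     ∎
  where
  open ≡-Reasoning
  regroup : ∀ s a b → s + a + b ≡ s + b + a
  regroup = solve-∀
  j≤m : j ≤ m
  j≤m = ℕₚ.≤-pred (ℕₚ.≤∧≢⇒< j≤1+m j≢1+m)
  lower : ∀ l → 1 ≤ l → l ≤ m → l ≢ j → g l ≡ f l
  lower l 1≤l l≤m = g≗f l 1≤l (ℕₚ.m≤n⇒m≤1+n l≤m)
  top : g (suc m) ≡ f (suc m)
  top = g≗f (suc m) (s≤s z≤n) ℕₚ.≤-refl (λ 1+m≡j → j≢1+m (sym 1+m≡j))

sumTo-swap : ∀ {m i} (f g : ℕ → ℤ) → 1 ≤ i → suc i ≤ m →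
             g i ≡ f (suc i) → g (suc i) ≡ f i →
             (∀ l → 1 ≤ l → l ≤ m → l ≢ i → l ≢ suc i → g l ≡ f l) →
             sumTo m g ≡ sumTo m f
sumTo-swap {i = zero} _ _ ()
sumTo-swap {zero} {suc _} _ _ _ ()
sumTo-swap {suc m} {suc i} f g _ 2+i≤1+m gi≡fi+1 gi+1≡fi g≗f with m ≟ suc i
... | yes refl = begin
  sumTo i g + g (suc i) + g (suc (suc i)) ≡⟨ cong₂ _+_ (cong₂ _+_ (sumTo-cong i lower) gi≡fi+1) gi+1≡fi ⟩
  sumTo i f + f (suc (suc i)) + f (suc i) ≡⟨ regroup (sumTo i f) (f (suc (suc i))) (f (suc i)) ⟩
  sumTo i f + f (suc i) + f (suc (suc i)) ∎
  where
  open ≡-Reasoning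
  regroup : ∀ s a b → s + a + b ≡ s + b + a
  regroup = solve-∀
  lower : ∀ l → 1 ≤ l → l ≤ i → g l ≡ f l
  lower l 1≤l l≤i = g≗f l 1≤l (ℕₚ.≤-trans l≤i (ℕₚ.≤-trans (ℕₚ.n≤1+n i) (ℕₚ.n≤1+n (suc i))))
                      (ℕₚ.<⇒≢ (s≤s l≤i)) (ℕₚ.<⇒≢ (ℕₚ.m≤n⇒m≤1+n (s≤s l≤i)))
... | no m≢1+i = cong₂ _+_ (sumTo-swap f g (s≤s z≤n) 2+i≤m gi≡fi+1 gi+1≡fi lower) top
  where
  1+i≤m : suc i ≤ m
  1+i≤m = ℕₚ.≤-pred 2+i≤1+m
  2+i≤m : suc (suc i) ≤ m
  2+i≤m = ℕₚ.≤∧≢⇒< 1+i≤m (λ 1+i≡m → m≢1+i (sym 1+i≡m))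
  lower : ∀ l → 1 ≤ l → l ≤ m → l ≢ suc i → l ≢ suc (suc i) → g l ≡ f l
  lower l 1≤l l≤m = g≗f l 1≤l (ℕₚ.m≤n⇒m≤1+n l≤m)
  top : g (suc m) ≡ f (suc m)
  top = g≗f (suc m) (s≤s z≤n) ℕₚ.≤-refl (ℕₚ.>⇒≢ (s≤s 1+i≤m)) (λ 2+i≡2+m → m≢1+i (ℕₚ.suc-injective 2+i≡2+m))

module _ (n k : ℕ) where

  signedTerm : ℤ → ℤ
  signedTerm y = eps n k y * y

  signedSum : (ℤ → ℤ) → ℤ
  signedSum U = sumTo n (λ j → signedTerm (U (+ j)))

  SignFormula : State → (ℤ → ℤ) → Set
  SignFormula p U =
    (∀ j → 1 ≤ j → j ≤ n → proj₁ p j ≡ eps n k (U (+ j)))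
    × (modulusℤ n * proj₂ p ≡ signedSum (λ x → x) - signedSum U)

module _ {n k : ℕ} (k<n : k < n) where

  eps-window : ∀ {j} → j ≤ n → eps n k (+ j) ≡ proj₁ (omega k) j
  eps-window {j} j≤n = trans (cong (residueSign n k) (res-residue n (window<modulus j≤n))) sign≡omega
    where
    omega-at : Bool → ℤ
    omega-at b = if b then + 0 else + 1
    sign≡omega : residueSign n k j ≡ proj₁ (omega k) j
    sign≡omega with j ≤? k
    ... | yes j≤k = trans (residueSign-zero n k k<n (inj₁ j≤k)) (cong omega-at (sym (≤⇒≤ᵇ-true j≤k)))
    ... | no j≰k  = trans (residueSign-pos n k k<n (ℕₚ.≰⇒> j≰k) j≤n) (cong omega-at (sym (≰⇒≤ᵇ-false j≰k)))


  signedTerm-neg : ∀ y → signedTerm n k (- y) ≡ signedTerm n k y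
  signedTerm-neg y = begin
    eps n k (- y) * - y    ≡⟨ cong (_* - y) (eps-odd n k k<n y) ⟩
    - eps n k y * - y      ≡⟨ ℤₚ.neg-distribˡ-* (eps n k y) (- y) ⟨
    - (eps n k y * - y)    ≡⟨ cong -_ (ℤₚ.neg-distribʳ-* (eps n k y) y) ⟨
    - - (eps n k y * y)    ≡⟨ ℤₚ.neg-involutive _ ⟩
    eps n k y * y          ∎
    where open ≡-Reasoning

  formula-ω : ∀ {U} → (∀ x → U x ≡ x) → SignFormula n k (omega k) U
  formula-ω {U} U≗id = coordinates , height
    where
    coordinates : ∀ j → 1 ≤ j → j ≤ n → proj₁ (omega k) j ≡ eps n k (U (+ j))
    coordinates j _ j≤n = sym (trans (cong (eps n k) (U≗id (+ j))) (eps-window j≤n))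
    height : modulusℤ n * + 0 ≡ signedSum n k (λ x → x) - signedSum n k U
    height = begin
      modulusℤ n * + 0                                    ≡⟨ ℤₚ.*-zeroʳ (modulusℤ n) ⟩
      + 0                                                 ≡⟨ ℤₚ.+-inverseʳ (signedSum n k (λ x → x)) ⟨
      signedSum n k (λ x → x) - signedSum n k (λ x → x)  ≡⟨ cong (λ t → signedSum n k (λ x → x) - t) id≡U ⟩
      signedSum n k (λ x → x) - signedSum n k U           ∎
      where
      open ≡-Reasoning
      id≡U : signedSum n k (λ x → x) ≡ signedSum n k U
      id≡U = sumTo-cong n (λ j _ _ → cong (signedTerm n k) (sym (U≗id (+ j))))

module _ {n k : ℕ} (k<n : k < n) (0<n : 0 < n) {p : State} {U V : ℤ → ℤ}
         (U-odd : Odd U) (U-equivariant : Equivariant n U) where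

  private
    S₀ = signedSum n k (λ x → x)

  formula-step-first : (∀ x → V x ≡ U (genAct n 0 x)) → SignFormula n k p U →
                       SignFormula n k (rhoGen n 0 p) V
  formula-step-first V≗U∘s (coordinates , height) = coordinates′ , trans height (cong (λ t → S₀ - t) sums)
    where
    open FirstGenerator n 0<n
    V-1 : V (+ 1) ≡ - U (+ 1)
    V-1 = trans (V≗U∘s (+ 1)) (trans (cong U genAct-1) (U-odd (+ 1)))
    V-fixed : ∀ {j} → 1 < j → j ≤ n → V (+ j) ≡ U (+ j)
    V-fixed 1<j j≤n = trans (V≗U∘s _) (cong U (genAct-fixed 1<j j≤n))
    coordinates′ : ∀ j → 1 ≤ j → j ≤ n → proj₁ (rhoGen n 0 p) j ≡ eps n k (V (+ j))
    coordinates′ j 1≤j j≤n with j ≟ 1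
    ... | yes refl = trans (cong -_ (coordinates 1 1≤j j≤n))
                           (sym (trans (cong (eps n k) V-1) (eps-odd n k k<n (U (+ 1)))))
    ... | no j≢1 rewrite ≢⇒≡ᵇ-false j≢1 =
      trans (coordinates j 1≤j j≤n) (cong (eps n k) (sym (V-fixed (ℕₚ.≤∧≢⇒< 1≤j (j≢1 ∘ sym)) j≤n)))
    sums : signedSum n k U ≡ signedSum n k V
    sums = sumTo-cong n terms
      where
      terms : ∀ j → 1 ≤ j → j ≤ n → signedTerm n k (U (+ j)) ≡ signedTerm n k (V (+ j))
      terms j 1≤j j≤n with j ≟ 1
      ... | yes refl = trans (sym (signedTerm-neg k<n (U (+ 1)))) (cong (signedTerm n k) (sym V-1))
      ... | no j≢1 = cong (signedTerm n k) (sym (V-fixed (ℕₚ.≤∧≢⇒< 1≤j (j≢1 ∘ sym)) j≤n))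

  formula-step-last : (∀ x → V x ≡ U (genAct n n x)) → SignFormula n k p U →
                      SignFormula n k (rhoGen n n p) V
  formula-step-last V≗U∘s (coordinates , height) = coordinates′ , height′
    where
    open LastGenerator n 0<n
    y = U (+ n)
    e = eps n k y
    N = modulusℤ n
    V-n : V (+ n) ≡ - y + N
    V-n = trans (V≗U∘s (+ n))
                (trans (cong U genAct-n) (trans (U-equivariant (- + n)) (cong (_+ N) (U-odd (+ n)))))
    eps-V-n : eps n k (V (+ n)) ≡ - e
    eps-V-n = trans (cong (eps n k) V-n) (trans (eps-periodic n k (- y)) (eps-odd n k k<n y))
    V-fixed : ∀ {j} → j < n → V (+ j) ≡ U (+ j)
    V-fixed j<n = trans (V≗U∘s _) (cong U (genAct-fixed j<n))
    coordinates′ : ∀ j → 1 ≤ j → j ≤ n → proj₁ (rhoGen n n p) j ≡ eps n k (V (+ j))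
    coordinates′ j 1≤j j≤n with j ≟ n
    ... | yes refl = trans (rhoGen-n p) (trans (cong -_ (coordinates n 1≤j j≤n)) (sym eps-V-n))
    ... | no j≢n = trans (rhoGen-other p j≢n)
                         (trans (coordinates j 1≤j j≤n) (cong (eps n k) (sym (V-fixed (ℕₚ.≤∧≢⇒< j≤n j≢n)))))
    sums : signedSum n k V ≡ signedSum n k U + (signedTerm n k (V (+ n)) - e * y)
    sums = sumTo-update (λ j → signedTerm n k (U (+ j))) (λ j → signedTerm n k (V (+ j))) 0<n ℕₚ.≤-refl
             (λ l _ l≤n l≢n → cong (signedTerm n k) (V-fixed (ℕₚ.≤∧≢⇒< l≤n l≢n)))
    height′ : N * proj₂ (rhoGen n n p) ≡ S₀ - signedSum n k V
    height′ = begin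
      N * proj₂ (rhoGen n n p)                              ≡⟨ cong (N *_) (rhoGen-height p) ⟩
      N * (proj₂ p + proj₁ p n)                             ≡⟨ ℤₚ.*-distribˡ-+ N (proj₂ p) (proj₁ p n) ⟩
      N * proj₂ p + N * proj₁ p n                           ≡⟨ cong₂ _+_ height (cong (N *_) (coordinates n 0<n ℕₚ.≤-refl)) ⟩
      (S₀ - signedSum n k U) + N * e                        ≡⟨ shift S₀ (signedSum n k U) e y N ⟩
      S₀ - (signedSum n k U + ((- e) * (- y + N) - e * y)) ≡⟨ cong (λ t → S₀ - (signedSum n k U + (t - e * y)))
                                                                (cong₂ _*_ eps-V-n V-n) ⟨
      S₀ - (signedSum n k U + (signedTerm n k (V (+ n)) - e * y)) ≡⟨ cong (λ t → S₀ - t) sums ⟨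
      S₀ - signedSum n k V                                  ∎
      where
      open ≡-Reasoning
      shift : ∀ S T e y m → (S - T) + m * e ≡ S - (T + ((- e) * (- y + m) - e * y))
      shift = solve-∀

  formula-step-middle : ∀ {i} → 0 < i → i < n → (∀ x → V x ≡ U (genAct n i x)) → SignFormula n k p U →
                        SignFormula n k (rhoGen n i p) V
  formula-step-middle {i} 0<i i<n V≗U∘s (coordinates , height) =
    coordinates′ , trans (cong (modulusℤ n *_) (rhoGen-height p)) (trans height (cong (λ t → S₀ - t) sums))
    where
    open MiddleGenerator n i 0<i i<n
    V-i : V (+ i) ≡ U (+ suc i)
    V-i = trans (V≗U∘s _) (cong U genAct-i)
    V-1+i : V (+ suc i) ≡ U (+ i)
    V-1+i = trans (V≗U∘s _) (cong U genAct-1+i)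
    V-fixed : ∀ {j} → j ≤ n → j ≢ i → j ≢ suc i → V (+ j) ≡ U (+ j)
    V-fixed j≤n j≢i j≢1+i = trans (V≗U∘s _) (cong U (genAct-fixed j≤n j≢i j≢1+i))
    coordinates′ : ∀ j → 1 ≤ j → j ≤ n → proj₁ (rhoGen n i p) j ≡ eps n k (V (+ j))
    coordinates′ j 1≤j j≤n with j ≟ i | j ≟ suc i
    ... | yes refl | _ =
      trans (rhoGen-i p) (trans (coordinates (suc i) (s≤s z≤n) i<n) (cong (eps n k) (sym V-i)))
    ... | no _ | yes refl =
      trans (rhoGen-1+i p) (trans (coordinates i 0<i (ℕₚ.<⇒≤ i<n)) (cong (eps n k) (sym V-1+i)))
    ... | no j≢i | no j≢1+i = trans (rhoGen-other p j≢i j≢1+i)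
                                    (trans (coordinates j 1≤j j≤n) (cong (eps n k) (sym (V-fixed j≤n j≢i j≢1+i))))
    sums : signedSum n k U ≡ signedSum n k V
    sums = sym (sumTo-swap (λ j → signedTerm n k (U (+ j))) (λ j → signedTerm n k (V (+ j))) 0<i i<n
                  (cong (signedTerm n k) V-i) (cong (signedTerm n k) V-1+i)
                  (λ l _ l≤n l≢i l≢1+i → cong (signedTerm n k) (V-fixed l≤n l≢i l≢1+i)))

  formula-step : ∀ {i} → i ≤ n → (∀ x → V x ≡ U (genAct n i x)) → SignFormula n k p U →
                 SignFormula n k (rhoGen n i p) V
  formula-step i≤n with generator i≤n
  ... | first          = formula-step-first
  ... | last           = formula-step-last
  ... | middle 0<i i<n = formula-step-middle 0<i i<n

module _ {n k : ℕ} (k<n : k < n) (0<n : 0 < n) where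

  formula-for-words : ∀ w U → (∀ x → act n w (U x) ≡ x) → SignFormula n k (rho n w (omega k)) U
  formula-for-words []      U act∘U≗id = formula-ω k<n act∘U≗id
  formula-for-words (i ∷ w) U act∘U≗id =
    formula-step k<n 0<n U′-odd U′-equivariant i≤n U≗U′∘s (formula-for-words w U′ act∘U′≗id)
    where
    i≤n : toℕ i ≤ n
    i≤n = toℕ≤pred[n] i
    s = genAct n (toℕ i)
    U′ : ℤ → ℤ
    U′ x = U (s x)
    act∘U′≗id : ∀ x → act n w (U′ x) ≡ x
    act∘U′≗id x = genAct-injective 0<n i≤n (act∘U≗id (s x))
    U′-odd : Odd U′
    U′-odd = right-inverse-odd (act-injective 0<n w) act∘U′≗id (act-odd 0<n w)
    U′-equivariant : Equivariant n U′
    U′-equivariant = right-inverse-equivariant (act-injective 0<n w) act∘U′≗id {n} (act-equivariant 0<n w)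
    U≗U′∘s : ∀ x → U x ≡ U′ (s x)
    U≗U′∘s x = cong U (sym (genAct-involutive 0<n i≤n x))

lemma3p8 : (n : ℕ) → 2 ≤ n → (k : ℕ) → k < n →
    (w : List (Fin (suc n))) → (uinv : ℤ → ℤ) →
    (∀ x → act n w (uinv x) ≡ x) →
    ((j : ℕ) → 1 ≤ j → j ≤ n →
        proj₁ (rho n w (omega k)) j ≡ eps n k (uinv (+ j)))
    × ((+ modulus n) * proj₂ (rho n w (omega k))
        ≡ sumTo n (λ j → eps n k (+ j) * + j)
          - sumTo n (λ j → eps n k (uinv (+ j)) * uinv (+ j)))
lemma3p8 n 2≤n k k<n = formula-for-words k<n (ℕₚ.<-trans (s≤s z≤n) 2≤n)
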